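{- Let $s\ge2$, $k\ge1$, $0\le t\le k$, $\lambda\ge1$ be integers. Consider the linear system in variables $(N_{\mathbf x})_{\mathbf x\in[s]^k}$ consisting of the equations \[ \sum_{\mathbf x\in[s]^k,\ x_i=a_i\ \forall i\in I}N_{\mathbf x}=\lambda\qquad\text{for all $t$-subsets } I\subseteq\{1,\dots,k\}\text{ and all }\mathbf a\in[s]^k, \] and let $G$ be the group of all permutations $\sigma$ of $[s]^k$ such that the coordinate permutation $N_{\mathbf x}\mapsto N_{\sigma(\mathbf x)}$ maps this set of equations onto itself (i.e. permutes the rows of its constraint matrix). If $t\ne0$ and $t\ne k$, then $G=G_{s,k}$, where $G_{s,k}\cong S_s\wr S_k$ is the group of permutations of $[s]^k$ generated by permutations of the $k$ coordinates and permutations of the levels $\{1,\dots,s\}$ within individual coordinates. If $t=0$ or $t=k$, then $G$ is the full symmetric group $S_{s^k}$ on $[s]^k$.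
   Context: $[s]=\{1,\dots,s\}$. The system above is the system whose nonnegative integer solutions correspond to orthogonal arrays $\mathrm{OA}(\lambda s^t,k,s,t)$, with $N_{\mathbf x}$ the number of times the level combination $\mathbf x$ appears as a run. -}

module Defs where

open import Data.Nat using (ℕ; zero; suc)
open import Data.Fin using (Fin)
open import Data.Fin.Subset using (Subset; _∈_; ∣_∣)
open import Data.Fin.Permutation using (Permutation′; _⟨$⟩ʳ_)
open import Data.Vec using (Vec; lookup; tabulate; updateAt)
open import Data.Product using (Σ; _×_; _,_; ∃)
open import Function using (_∘_; id)
open import Function.Bundles using (_↔_; Inverse)
open import Relation.Binary.PropositionalEquality using (_≡_)
open import Relation.Nullary using (¬_)

Point : ℕ → ℕ → Set
Point s k = Vec (Fin s) k

PointPerm : ℕ → ℕ → Set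
PointPerm s k = Point s k ↔ Point s k

Agree : ∀ {s k} → Subset k → Point s k → Point s k → Set
Agree I a x = ∀ i → i ∈ I → lookup x i ≡ lookup a i

record Equation (s k : ℕ) : Set where
  constructor eqn
  field
    coeff : Point s k → ℕ
    rhs   : ℕ
open Equation public

_≈E_ : ∀ {s k} → Equation s k → Equation s k → Set
e ≈E f = (∀ x → coeff e x ≡ coeff f x) × (rhs e ≡ rhs f)

InSystem : ∀ {s k} → ℕ → ℕ → Equation s k → Set
InSystem {s} {k} t λ' e =
  Σ (Subset k) λ I → Σ (Point s k) λ a →
    (∣ I ∣ ≡ t) ×
    (∀ x → (Agree I a x → coeff e x ≡ 1) × (¬ Agree I a x → coeff e x ≡ 0)) ×
    (rhs e ≡ λ')

-- Image of an equation under the substitution N_x ↦ N_{σ(x)}: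
-- Σ_x c(x) N_{σ(x)} = Σ_y c(σ⁻¹ y) N_y.
act : ∀ {s k} → PointPerm s k → Equation s k → Equation s k
act σ e = eqn (λ y → coeff e (Inverse.from σ y)) (rhs e)

Preserves : ∀ {s k} → ℕ → ℕ → PointPerm s k → Set
Preserves t λ' σ =
  (∀ e → InSystem t λ' e → InSystem t λ' (act σ e)) ×
  (∀ e → InSystem t λ' e → Σ _ λ e' → InSystem t λ' e' × (act σ e' ≈E e))

coordPerm : ∀ {s k} → Permutation′ k → Point s k → Point s k
coordPerm τ x = tabulate (λ i → lookup x (τ ⟨$⟩ʳ i))

levelPerm : ∀ {s k} → Fin k → Permutation′ s → Point s k → Point s k
levelPerm j π x = updateAt x j (π ⟨$⟩ʳ_)

-- Words in the generators (the group is finite, so the generated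
-- subgroup equals the set of finite products of generators).
data Word (s k : ℕ) : Set where
  done  : Word s k
  coord : Permutation′ k → Word s k → Word s k
  level : Fin k → Permutation′ s → Word s k → Word s k

eval : ∀ {s k} → Word s k → Point s k → Point s k
eval done          = id
eval (coord τ w)   = coordPerm τ ∘ eval w
eval (level j π w) = levelPerm j π ∘ eval w

InGsk : ∀ {s k} → PointPerm s k → Set
InGsk {s} {k} σ = Σ (Word s k) λ w → ∀ x → Inverse.to σ x ≡ eval w x

module Submission where

-- A t-flat is the set of points of [s]^k agreeing with a fixed point a on a
-- t-subset I of the coordinates; the equations of the system are exactly the
-- indicator rows of the t-flats.  Hence a permutation σ preserves the system
-- iff σ and σ⁻¹ carry t-flats onto t-flats (preserves⇒flats-to/-from and
-- flats⇒preserves).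
--
-- Monomial maps -- move coordinate i to position τ i and relabel its levels by
-- a permutation φ i -- carry flats onto flats, are closed under composition and
-- inversion, and are exactly the maps computed by words in the generators of
-- G_{s,k} (inGsk⇒monomial, monomial⇒inGsk).  This gives G_{s,k} ⊆ G.  For
-- t = 0 or t = k every bijection carries t-flats onto t-flats, so then G is
-- the full symmetric group.
--
-- For 1 ≤ t < k the converse goes through the Hamming graph: two points are
-- adjacent (differ in exactly one coordinate) iff a condition phrased purely
-- in terms of t-flats holds, so every σ ∈ G is an automorphism of the Hamming
-- graph.  Such an automorphism is determined by its action on the lines
-- through the origin, from which a monomial map agreeing with it is read off;
-- an induction on Hamming weight shows that the two coincide everywhere.

open import Defs
open import Data.Bool using (Bool; true; false)
open import Data.Nat using (ℕ; zero; suc; _≤_; _<_; _∸_; z≤n; s≤s)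
open import Data.Nat.Properties as ℕ using (≤∧≢⇒<; n≢0⇒n>0; suc-injective; m∸[m∸n]≡n; ∸-monoʳ-<)
open import Data.Fin using (Fin; zero; suc)
open import Data.Fin.Properties using (_≟_; all?; ¬∀⟶∃¬)
open import Data.Fin.Subset using (Subset; _∈_; _∉_; ∣_∣; inside; outside; ⁅_⁆; ⊥; ∁)
open import Data.Fin.Subset.Properties
  using (∣p∣≡n⇒p≡⊤; ∈⊤; _∈?_; ∉⊥; ∣⊥∣≡0; ∣⁅x⁆∣≡1; x∈⁅x⁆; x≢y⇒x∉⁅y⁆;
         ∣∁p∣≡n∸∣p∣; x∉p⇒x∈∁p)
open import Data.Fin.Permutation
  using (Permutation′; permutation; _⟨$⟩ʳ_; _⟨$⟩ˡ_; inverseˡ; inverseʳ; flip; _∘ₚ_)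
  renaming (id to idₚ)
open import Data.Vec using (Vec; []; _∷_; here; there; lookup; tabulate; replicate; _[_]≔_)
open import Data.Vec.Properties
  using ([]=⇒lookup; lookup⇒[]=; lookup∘tabulate; tabulate∘lookup; tabulate-cong;
         lookup∘updateAt; lookup∘updateAt′; updateAt-id-local; lookup-replicate)
open import Data.List using (List; []; _∷_; allFin)
open import Data.List.Membership.Propositional using () renaming (_∈_ to _∈ₗ_)
open import Data.List.Membership.Propositional.Properties using (∈-allFin)
open import Data.List.Relation.Unary.Any using (here; there)
open import Data.List.Relation.Unary.All as All using (All)
open import Data.List.Relation.Unary.AllPairs using (AllPairs; []; _∷_)
open import Data.List.Relation.Unary.Unique.Propositional.Properties using (allFin⁺)
open import Data.Product using (Σ; _×_; _,_; proj₁; proj₂)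
open import Data.Sum using (_⊎_; inj₁; inj₂)
open import Data.Empty using (⊥-elim)
open import Function using (_∘_)
open import Function.Bundles using (Inverse; _⇔_; mk⇔)
open import Relation.Binary.PropositionalEquality
open import Relation.Nullary using (¬_; Dec; yes; no)
open import Relation.Nullary.Decidable using (_→-dec_)
import Algebra.Properties.CommutativeMonoid.Sum as Sums

private
  variable
    s k : ℕ

point-ext : ∀ {A : Set} {n} {x y : Vec A n} → (∀ i → lookup x i ≡ lookup y i) → x ≡ y
point-ext {x = x} {y} eq = trans (sym (tabulate∘lookup x)) (trans (tabulate-cong eq) (tabulate∘lookup y))

perm-injective : ∀ {n} (π : Permutation′ n) {a b : Fin n} → π ⟨$⟩ʳ a ≡ π ⟨$⟩ʳ b → a ≡ b
perm-injective π {a} {b} eq = trans (sym (inverseˡ π)) (trans (cong (π ⟨$⟩ˡ_) eq) (inverseˡ π))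

∈⇒lookup : ∀ {n} {i : Fin n} {p : Subset n} → i ∈ p → lookup p i ≡ inside
∈⇒lookup = []=⇒lookup

lookup⇒∈ : ∀ {n} {i : Fin n} {p : Subset n} → lookup p i ≡ inside → i ∈ p
lookup⇒∈ {i = i} {p} = lookup⇒[]= i p

agree? : (I : Subset k) (a x : Point s k) → Dec (Agree I a x)
agree? I a x = all? (λ i → (i ∈? I) →-dec (lookup x i ≟ lookup a i))

indicator : ∀ {P : Set} → Dec P → ℕ
indicator (yes _) = 1
indicator (no _)  = 0

IsRow : Subset k → Point s k → (Point s k → ℕ) → Set
IsRow I a c = ∀ x → (Agree I a x → c x ≡ 1) × (¬ Agree I a x → c x ≡ 0)

flatRow : (I : Subset k) (a : Point s k) → IsRow I a (λ x → indicator (agree? I a x))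
flatRow I a x with agree? I a x
... | yes ag = (λ _ → refl) , (λ ¬ag → ⊥-elim (¬ag ag))
... | no ¬ag = (λ ag → ⊥-elim (¬ag ag)) , (λ _ → refl)

row-agree : ∀ {I : Subset k} {a : Point s k} {c} → IsRow I a c → ∀ x → c x ≡ 1 → Agree I a x
row-agree {I = I} {a} row x c≡1 with agree? I a x
... | yes ag = ag
... | no ¬ag with trans (sym c≡1) (proj₂ (row x) ¬ag)
...   | ()

row-cong : ∀ {I : Subset k} {a : Point s k} {c d} → (∀ x → c x ≡ d x) → IsRow I a c → IsRow I a d
row-cong c≗d row x = (λ ag → trans (sym (c≗d x)) (proj₁ (row x) ag)) ,
                     (λ ¬ag → trans (sym (c≗d x)) (proj₂ (row x) ¬ag))

flatEquation : ℕ → Subset k → Point s k → Equation s k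
flatEquation λ' I a = eqn (λ x → indicator (agree? I a x)) λ'

flatEquation-inSystem : ∀ t λ' (I : Subset k) (a : Point s k) → ∣ I ∣ ≡ t →
                        InSystem t λ' (flatEquation λ' I a)
flatEquation-inSystem t λ' I a ∣I∣≡t = I , a , ∣I∣≡t , flatRow I a , refl

FlatImage : (Point s k → Point s k) → Subset k → Point s k → Subset k → Point s k → Set
FlatImage h I a J b = ∀ x → (Agree I a x → Agree J b (h x)) × (Agree J b (h x) → Agree I a x)

MapsFlats : ℕ → (Point s k → Point s k) → Set
MapsFlats {s} {k} t h = ∀ (I : Subset k) (a : Point s k) → ∣ I ∣ ≡ t →
  Σ (Subset k) λ J → Σ (Point s k) λ b → (∣ J ∣ ≡ t) × FlatImage h I a J b

flatImage-inverse : ∀ {h h′ : Point s k → Point s k} {I a J b} →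
                    (∀ y → h (h′ y) ≡ y) → FlatImage h I a J b → FlatImage h′ J b I a
flatImage-inverse {I = I} {a} {J} {b} hh′ img y =
  (λ ag → proj₂ (img _) (subst (Agree J b) (sym (hh′ y)) ag)) ,
  (λ ag → subst (Agree J b) (hh′ y) (proj₁ (img _) ag))

row-pullback : ∀ {h : Point s k → Point s k} {I a J b c} →
               FlatImage h J b I a → IsRow I a c → IsRow J b (c ∘ h)
row-pullback img row x =
  (λ ag → proj₁ (row _) (proj₁ (img x) ag)) ,
  (λ ¬ag → proj₂ (row _) (λ ag → ¬ag (proj₂ (img x) ag)))

row-flatImage : ∀ {h : Point s k → Point s k} {I a J b c} →
                IsRow I a c → IsRow J b (c ∘ h) → FlatImage h J b I a
row-flatImage {h = h} {I} {a} {J} {b} row row∘h x =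
  (λ ag → row-agree {I = I} {a} row (h x) (proj₁ (row∘h x) ag)) ,
  (λ ag → row-agree {I = J} {b} row∘h x (proj₁ (row (h x)) ag))

module _ (σ : PointPerm s k) where
  private
    to from : Point s k → Point s k
    to   = Inverse.to σ
    from = Inverse.from σ

  from-to : ∀ x → from (to x) ≡ x
  from-to x = Inverse.inverseʳ σ refl

  to-from : ∀ y → to (from y) ≡ y
  to-from y = Inverse.inverseˡ σ refl

  to-injective : ∀ x y → to x ≡ to y → x ≡ y
  to-injective x y eq = trans (sym (from-to x)) (trans (cong from eq) (from-to y))

  from-injective : ∀ x y → from x ≡ from y → x ≡ y
  from-injective x y eq = trans (sym (to-from x)) (trans (cong to eq) (to-from y))

  module _ (t λ' : ℕ) where
    -- The image of a flat equation is an equation of the system; its row is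
    -- the indicator of the image flat.
    preserves⇒flats-to : Preserves t λ' σ → MapsFlats t to
    preserves⇒flats-to (forward , _) I a ∣I∣≡t
      with forward _ (flatEquation-inSystem t λ' I a ∣I∣≡t)
    ... | J , b , ∣J∣≡t , row , _ =
      J , b , ∣J∣≡t , flatImage-inverse {h = from} {h′ = to} {J} {b} {I} {a} from-to
                        (row-flatImage {h = from} {I = I} {a} {J} {b} (flatRow I a) row)

    -- A flat equation is the image of an equation of the system, whose row
    -- is the indicator of the image of the flat under σ⁻¹.
    preserves⇒flats-from : Preserves t λ' σ → MapsFlats t from
    preserves⇒flats-from (_ , backward) I a ∣I∣≡t
      with backward _ (flatEquation-inSystem t λ' I a ∣I∣≡t)
    ... | e , (J , b , ∣J∣≡t , row , _) , (same , _) =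
      J , b , ∣J∣≡t , row-flatImage {h = from} {I = J} {b} {I} {a} row
                        (row-cong {I = I} {a} (λ x → sym (same x)) (flatRow I a))

    -- Conversely, the row of a flat composed with σ⁻¹ (with σ) is the row
    -- of its image under σ (under σ⁻¹).
    flats⇒preserves : MapsFlats t to → MapsFlats t from → Preserves t λ' σ
    flats⇒preserves flats-to flats-from = forward , backward
      where
      forward : ∀ e → InSystem t λ' e → InSystem t λ' (act σ e)
      forward e (I , a , ∣I∣≡t , row , rhs≡) with flats-to I a ∣I∣≡t
      ... | J , b , ∣J∣≡t , img =
        J , b , ∣J∣≡t , row-pullback {h = from} {I} {a} {J} {b}
                          (flatImage-inverse {h = to} {h′ = from} {I} {a} {J} {b} to-from img) row , rhs≡

      backward : ∀ e → InSystem t λ' e → Σ (Equation s k) λ e′ → InSystem t λ' e′ × (act σ e′ ≈E e)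
      backward e (I , a , ∣I∣≡t , row , rhs≡) with flats-from I a ∣I∣≡t
      ... | J , b , ∣J∣≡t , img =
        eqn (coeff e ∘ to) (rhs e) ,
        (J , b , ∣J∣≡t , row-pullback {h = to} {I} {a} {J} {b}
                           (flatImage-inverse {h = from} {h′ = to} {I} {a} {J} {b} from-to img) row , rhs≡) ,
        (λ y → cong (coeff e) (to-from y)) , refl

∣p∣≡0⇒∉ : ∀ {n} (p : Subset n) → ∣ p ∣ ≡ 0 → ∀ i → i ∉ p
∣p∣≡0⇒∉ (outside ∷ p) eq zero    ()
∣p∣≡0⇒∉ (outside ∷ p) eq (suc i) (there i∈p) = ∣p∣≡0⇒∉ p eq i i∈p
∣p∣≡0⇒∉ (inside ∷ p)  () i

∣p∣≡n⇒∈ : ∀ {n} (p : Subset n) → ∣ p ∣ ≡ n → ∀ i → i ∈ p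
∣p∣≡n⇒∈ p eq i = subst (i ∈_) (sym (∣p∣≡n⇒p≡⊤ eq)) ∈⊤

-- For t = 0 the only t-flat is the whole space, so every map carries
-- t-flats onto t-flats.
mapsFlats-t≡0 : ∀ {t} → t ≡ 0 → (h : Point s k → Point s k) → MapsFlats t h
mapsFlats-t≡0 t≡0 h I a ∣I∣≡t = I , a , ∣I∣≡t , λ x → (λ _ → vacuous a (h x)) , (λ _ → vacuous a x)
  where
  vacuous : ∀ (b y : Point _ _) → Agree I b y
  vacuous b y i i∈I = ⊥-elim (∣p∣≡0⇒∉ I (trans ∣I∣≡t t≡0) i i∈I)

-- For t = k the t-flats are the single points, so every injective map
-- carries t-flats onto t-flats.
mapsFlats-t≡k : ∀ {t} → t ≡ k → (h : Point s k → Point s k) →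
                (∀ x y → h x ≡ h y → x ≡ y) → MapsFlats t h
mapsFlats-t≡k t≡k h injective I a ∣I∣≡t = I , h a , ∣I∣≡t , λ x →
  (λ ag → same-point (cong h (point-of ag))) ,
  (λ ag → same-point (injective x a (point-of ag)))
  where
  point-of : ∀ {b y : Point _ _} → Agree I b y → y ≡ b
  point-of ag = point-ext λ i → ag i (∣p∣≡n⇒∈ I (trans ∣I∣≡t t≡k) i)
  same-point : ∀ {b y : Point _ _} → y ≡ b → Agree I b y
  same-point refl i _ = refl

-- h is monomial with data (τ , φ): coordinate i of x is moved to position
-- τ i and its level is relabelled by φ i.  These are the elements of G_{s,k}.
record IsMonomial (τ : Permutation′ k) (φ : Fin k → Permutation′ s) (h : Point s k → Point s k) : Set where
  constructor monomial
  field moves : ∀ x i → lookup (h x) (τ ⟨$⟩ʳ i) ≡ φ i ⟨$⟩ʳ lookup x i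
open IsMonomial

Monomial : (Point s k → Point s k) → Set
Monomial {s} {k} h = Σ (Permutation′ k) λ τ → Σ (Fin k → Permutation′ s) λ φ → IsMonomial τ φ h

ext-along : ∀ {A : Set} (τ : Permutation′ k) {x y : Vec A k} →
            (∀ i → lookup x (τ ⟨$⟩ʳ i) ≡ lookup y (τ ⟨$⟩ʳ i)) → x ≡ y
ext-along τ {x} {y} eq = point-ext λ l → subst (λ m → lookup x m ≡ lookup y m) (inverseʳ τ) (eq (τ ⟨$⟩ˡ l))

module _ {τ : Permutation′ k} {φ : Fin k → Permutation′ s} {h : Point s k → Point s k}
         (mono : IsMonomial τ φ h) where

  monomial-lookup : ∀ x l → lookup (h x) l ≡ φ (τ ⟨$⟩ˡ l) ⟨$⟩ʳ lookup x (τ ⟨$⟩ˡ l)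
  monomial-lookup x l =
    subst (λ m → lookup (h x) m ≡ φ (τ ⟨$⟩ˡ l) ⟨$⟩ʳ lookup x (τ ⟨$⟩ˡ l)) (inverseʳ τ)
          (moves mono x (τ ⟨$⟩ˡ l))

  monomial-unique : ∀ {h′} → IsMonomial τ φ h′ → ∀ x → h x ≡ h′ x
  monomial-unique mono′ x = ext-along τ λ i → trans (moves mono x i) (sym (moves mono′ x i))

  monomial-update : ∀ x i c → h (x [ i ]≔ c) ≡ h x [ τ ⟨$⟩ʳ i ]≔ (φ i ⟨$⟩ʳ c)
  monomial-update x i c = ext-along τ at
    where
    at : ∀ j → lookup (h (x [ i ]≔ c)) (τ ⟨$⟩ʳ j)
             ≡ lookup (h x [ τ ⟨$⟩ʳ i ]≔ (φ i ⟨$⟩ʳ c)) (τ ⟨$⟩ʳ j)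
    at j with j ≟ i
    ... | yes refl = begin
      lookup (h (x [ j ]≔ c)) (τ ⟨$⟩ʳ j)          ≡⟨ moves mono _ j ⟩
      φ j ⟨$⟩ʳ lookup (x [ j ]≔ c) j              ≡⟨ cong (φ j ⟨$⟩ʳ_) (lookup∘updateAt j x) ⟩
      φ j ⟨$⟩ʳ c                                  ≡⟨ lookup∘updateAt (τ ⟨$⟩ʳ j) (h x) ⟨
      lookup (h x [ τ ⟨$⟩ʳ j ]≔ (φ j ⟨$⟩ʳ c)) (τ ⟨$⟩ʳ j) ∎
      where open ≡-Reasoning
    ... | no j≢i = begin
      lookup (h (x [ i ]≔ c)) (τ ⟨$⟩ʳ j)          ≡⟨ moves mono _ j ⟩
      φ j ⟨$⟩ʳ lookup (x [ i ]≔ c) j              ≡⟨ cong (φ j ⟨$⟩ʳ_) (lookup∘updateAt′ j i j≢i x) ⟩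
      φ j ⟨$⟩ʳ lookup x j                         ≡⟨ moves mono x j ⟨
      lookup (h x) (τ ⟨$⟩ʳ j)                     ≡⟨ lookup∘updateAt′ _ _ (j≢i ∘ perm-injective τ) (h x) ⟨
      lookup (h x [ τ ⟨$⟩ʳ i ]≔ (φ i ⟨$⟩ʳ c)) (τ ⟨$⟩ʳ j) ∎
      where open ≡-Reasoning

  monomial-inverse : ∀ {h′} → (∀ y → h (h′ y) ≡ y) →
                     IsMonomial (flip τ) (λ l → flip (φ (τ ⟨$⟩ˡ l))) h′
  monomial-inverse {h′} hh′ = monomial λ y l → let i = τ ⟨$⟩ˡ l in begin
    lookup (h′ y) i                             ≡⟨ inverseˡ (φ i) ⟨
    φ i ⟨$⟩ˡ (φ i ⟨$⟩ʳ lookup (h′ y) i)         ≡⟨ cong (φ i ⟨$⟩ˡ_) (moves mono (h′ y) i) ⟨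
    φ i ⟨$⟩ˡ lookup (h (h′ y)) (τ ⟨$⟩ʳ i)       ≡⟨ cong (φ i ⟨$⟩ˡ_) (cong₂ lookup (hh′ y) (inverseʳ τ)) ⟩
    φ i ⟨$⟩ˡ lookup y l                         ∎
    where open ≡-Reasoning

levelAt : Fin k → Permutation′ s → Fin k → Permutation′ s
levelAt j π i with i ≟ j
... | yes _ = π
... | no _  = idₚ

levelPerm-monomial : ∀ (j : Fin k) (π : Permutation′ s) → IsMonomial idₚ (levelAt j π) (levelPerm j π)
levelPerm-monomial j π = monomial moves-by
  where
  moves-by : ∀ x i → lookup (levelPerm j π x) i ≡ levelAt j π i ⟨$⟩ʳ lookup x i
  moves-by x i with i ≟ j
  ... | yes refl = lookup∘updateAt i x
  ... | no i≢j   = lookup∘updateAt′ i j i≢j x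

coordPerm-monomial : ∀ {s} (τ : Permutation′ k) → IsMonomial {s = s} (flip τ) (λ _ → idₚ) (coordPerm τ)
coordPerm-monomial τ = monomial λ x i → trans (lookup∘tabulate _ (τ ⟨$⟩ˡ i)) (cong (lookup x) (inverseʳ τ))

monomial-∘ : ∀ {τ τ′ : Permutation′ k} {φ φ′ : Fin k → Permutation′ s} {f g} →
             IsMonomial τ φ f → IsMonomial τ′ φ′ g →
             IsMonomial (τ′ ∘ₚ τ) (λ i → φ′ i ∘ₚ φ (τ′ ⟨$⟩ʳ i)) (f ∘ g)
monomial-∘ {τ′ = τ′} {φ = φ} {g = g} mf mg =
  monomial λ x i → trans (moves mf (g x) (τ′ ⟨$⟩ʳ i)) (cong (φ _ ⟨$⟩ʳ_) (moves mg x i))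

eval-monomial : (w : Word s k) → Monomial (eval w)
eval-monomial done = idₚ , (λ _ → idₚ) , monomial λ x i → refl
eval-monomial (coord τ w) with eval-monomial w
... | _ , _ , mw = _ , _ , monomial-∘ (coordPerm-monomial τ) mw
eval-monomial (level j π w) with eval-monomial w
... | _ , _ , mw = _ , _ , monomial-∘ (levelPerm-monomial j π) mw

image : Permutation′ k → Subset k → Subset k
image τ I = tabulate (λ l → lookup I (τ ⟨$⟩ˡ l))

∈-image : ∀ (τ : Permutation′ k) {I i} → i ∈ I → τ ⟨$⟩ʳ i ∈ image τ I
∈-image τ {I} {i} i∈I =
  lookup⇒∈ (trans (lookup∘tabulate (λ l → lookup I (τ ⟨$⟩ˡ l)) (τ ⟨$⟩ʳ i))
                  (trans (cong (lookup I) (inverseˡ τ)) (∈⇒lookup i∈I)))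

image-∈ : ∀ (τ : Permutation′ k) {I l} → l ∈ image τ I → τ ⟨$⟩ˡ l ∈ I
image-∈ τ {I} {l} l∈ = lookup⇒∈ (trans (sym (lookup∘tabulate _ l)) (∈⇒lookup l∈))

open Sums ℕ.+-0-commutativeMonoid using (sum; sum-cong-≗; sum-permute)

bit : Bool → ℕ
bit true  = 1
bit false = 0

∣p∣≡sum : ∀ {n} (p : Subset n) → ∣ p ∣ ≡ sum (λ i → bit (lookup p i))
∣p∣≡sum []           = refl
∣p∣≡sum (inside ∷ p)  = cong suc (∣p∣≡sum p)
∣p∣≡sum (outside ∷ p) = ∣p∣≡sum p

∣image∣ : ∀ (τ : Permutation′ k) (I : Subset k) → ∣ image τ I ∣ ≡ ∣ I ∣
∣image∣ {k} τ I = begin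
  ∣ image τ I ∣                                ≡⟨ ∣p∣≡sum (image τ I) ⟩
  sum {k} (λ l → bit (lookup (image τ I) l))   ≡⟨ sum-cong-≗ {k} (λ l → cong bit (lookup∘tabulate _ l)) ⟩
  sum {k} (λ l → bit (lookup I (τ ⟨$⟩ˡ l)))    ≡⟨ sum-permute (λ i → bit (lookup I i)) (flip τ) ⟨
  sum {k} (λ i → bit (lookup I i))             ≡⟨ ∣p∣≡sum I ⟨
  ∣ I ∣                                        ∎
  where open ≡-Reasoning

monomial-flatImage : ∀ {τ : Permutation′ k} {φ : Fin k → Permutation′ s} {h} → IsMonomial τ φ h →
                     ∀ I a → FlatImage h I a (image τ I) (h a)
monomial-flatImage {τ = τ} {φ} {h} mono I a x = forward , backward
  where
  forward : Agree I a x → Agree (image τ I) (h a) (h x)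
  forward ag l l∈ = begin
    lookup (h x) l                                ≡⟨ monomial-lookup mono x l ⟩
    φ (τ ⟨$⟩ˡ l) ⟨$⟩ʳ lookup x (τ ⟨$⟩ˡ l)          ≡⟨ cong (φ (τ ⟨$⟩ˡ l) ⟨$⟩ʳ_) (ag _ (image-∈ τ l∈)) ⟩
    φ (τ ⟨$⟩ˡ l) ⟨$⟩ʳ lookup a (τ ⟨$⟩ˡ l)          ≡⟨ monomial-lookup mono a l ⟨
    lookup (h a) l                                ∎
    where open ≡-Reasoning
  backward : Agree (image τ I) (h a) (h x) → Agree I a x
  backward ag i i∈I = perm-injective (φ i) (begin
    φ i ⟨$⟩ʳ lookup x i             ≡⟨ moves mono x i ⟨
    lookup (h x) (τ ⟨$⟩ʳ i)         ≡⟨ ag _ (∈-image τ i∈I) ⟩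
    lookup (h a) (τ ⟨$⟩ʳ i)         ≡⟨ moves mono a i ⟩
    φ i ⟨$⟩ʳ lookup a i             ∎)
    where open ≡-Reasoning

monomial-mapsFlats : ∀ t {h : Point s k → Point s k} → Monomial h → MapsFlats t h
monomial-mapsFlats t {h} (τ , φ , mono) I a ∣I∣≡t =
  image τ I , h a , trans (∣image∣ τ I) ∣I∣≡t , monomial-flatImage mono I a

levels : (Fin k → Permutation′ s) → List (Fin k) → Word s k → Word s k
levels ρ []       w = w
levels ρ (j ∷ js) w = level j (ρ j) (levels ρ js w)

lookup-levels-∉ : ∀ (ρ : Fin k → Permutation′ s) js w x i → All (i ≢_) js →
                  lookup (eval (levels ρ js w) x) i ≡ lookup (eval w x) i
lookup-levels-∉ ρ []       w x i All.[]           = refl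
lookup-levels-∉ ρ (j ∷ js) w x i (i≢j All.∷ i∉js) =
  trans (lookup∘updateAt′ i j i≢j (eval (levels ρ js w) x)) (lookup-levels-∉ ρ js w x i i∉js)

lookup-levels-∈ : ∀ (ρ : Fin k → Permutation′ s) js w x i → AllPairs _≢_ js → i ∈ₗ js →
                  lookup (eval (levels ρ js w) x) i ≡ ρ i ⟨$⟩ʳ lookup (eval w x) i
lookup-levels-∈ ρ (j ∷ js) w x .j (j∉js ∷ _) (here refl) =
  trans (lookup∘updateAt j (eval (levels ρ js w) x)) (cong (ρ j ⟨$⟩ʳ_) (lookup-levels-∉ ρ js w x j j∉js))
lookup-levels-∈ ρ (j ∷ js) w x i (j∉js ∷ distinct) (there i∈js) =
  trans (lookup∘updateAt′ i j (λ i≡j → All.lookup j∉js i∈js (sym i≡j)) (eval (levels ρ js w) x))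
        (lookup-levels-∈ ρ js w x i distinct i∈js)

-- Every monomial map is computed by a word: permute the coordinates by τ,
-- then relabel the levels at every position.
monomial-word : ∀ (τ : Permutation′ k) (φ : Fin k → Permutation′ s) →
                Σ (Word s k) λ w → IsMonomial τ φ (eval w)
monomial-word {k} τ φ = levels ρ (allFin k) (coord (flip τ) done) , monomial computes
  where
  ρ : Fin k → Permutation′ _
  ρ l = φ (τ ⟨$⟩ˡ l)
  computes : ∀ x i → lookup (eval (levels ρ (allFin k) (coord (flip τ) done)) x) (τ ⟨$⟩ʳ i)
                   ≡ φ i ⟨$⟩ʳ lookup x i
  computes x i = begin
    lookup (eval (levels ρ (allFin k) (coord (flip τ) done)) x) (τ ⟨$⟩ʳ i)
      ≡⟨ lookup-levels-∈ ρ (allFin k) _ x _ (allFin⁺ k) (∈-allFin _) ⟩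
    ρ (τ ⟨$⟩ʳ i) ⟨$⟩ʳ lookup (coordPerm (flip τ) x) (τ ⟨$⟩ʳ i)
      ≡⟨ cong (ρ (τ ⟨$⟩ʳ i) ⟨$⟩ʳ_) (lookup∘tabulate (λ l → lookup x (τ ⟨$⟩ˡ l)) (τ ⟨$⟩ʳ i)) ⟩
    φ (τ ⟨$⟩ˡ (τ ⟨$⟩ʳ i)) ⟨$⟩ʳ lookup x (τ ⟨$⟩ˡ (τ ⟨$⟩ʳ i))
      ≡⟨ cong (λ m → φ m ⟨$⟩ʳ lookup x m) (inverseˡ τ) ⟩
    φ i ⟨$⟩ʳ lookup x i ∎
    where open ≡-Reasoning

inGsk⇒monomial : ∀ (σ : PointPerm s k) → InGsk σ → Monomial (Inverse.to σ)
inGsk⇒monomial σ (w , to≡eval) with eval-monomial w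
... | τ , φ , mono =
  τ , φ , monomial λ x i → trans (cong (λ y → lookup y (τ ⟨$⟩ʳ i)) (to≡eval x)) (moves mono x i)

monomial⇒inGsk : ∀ (σ : PointPerm s k) → Monomial (Inverse.to σ) → InGsk σ
monomial⇒inGsk σ (τ , φ , mono) with monomial-word τ φ
... | w , mono-w = w , monomial-unique mono mono-w

inGsk⇒preserves : ∀ t λ' (σ : PointPerm s k) → InGsk σ → Preserves t λ' σ
inGsk⇒preserves t λ' σ inG with inGsk⇒monomial σ inG
... | τ , φ , mono = flats⇒preserves σ t λ' (monomial-mapsFlats t (τ , φ , mono))
                       (monomial-mapsFlats t (_ , _ , monomial-inverse mono (to-from σ)))

subsetOfSize : ∀ n m → m ≤ n → Σ (Subset n) λ J → ∣ J ∣ ≡ m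
subsetOfSize n       zero    _         = ⊥ , ∣⊥∣≡0 n
subsetOfSize (suc n) (suc m) (s≤s m≤n) with subsetOfSize n m m≤n
... | J , ∣J∣≡m = inside ∷ J , cong suc ∣J∣≡m

subsetAvoiding : ∀ {n} (j : Fin n) m → m < n → Σ (Subset n) λ J → (∣ J ∣ ≡ m) × (j ∉ J)
subsetAvoiding zero    m       (s≤s m≤n) with subsetOfSize _ m m≤n
... | J , ∣J∣≡m = outside ∷ J , ∣J∣≡m , λ ()
subsetAvoiding {n} (suc j) zero    _         = ⊥ , ∣⊥∣≡0 n , ∉⊥
subsetAvoiding (suc j) (suc m) (s≤s m<n) with subsetAvoiding j m m<n
... | J , ∣J∣≡m , j∉J = inside ∷ J , cong suc ∣J∣≡m , λ { (there j∈J) → j∉J j∈J }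

subsetContaining : ∀ {n} (i : Fin n) m → 1 ≤ m → m ≤ n → Σ (Subset n) λ J → (∣ J ∣ ≡ m) × (i ∈ J)
subsetContaining {n} i m 1≤m m≤n with subsetAvoiding i (n ∸ m) (∸-monoʳ-< {o = 0} 1≤m m≤n)
... | J , ∣J∣≡n∸m , i∉J =
  ∁ J , trans (∣∁p∣≡n∸∣p∣ J) (trans (cong (n ∸_) ∣J∣≡n∸m) (m∸[m∸n]≡n m≤n)) , x∉p⇒x∈∁p i∉J

subsetSeparating : ∀ {n} {i j : Fin n} → i ≢ j → ∀ m → 1 ≤ m → m < n →
                   Σ (Subset n) λ J → (∣ J ∣ ≡ m) × (i ∈ J) × (j ∉ J)
subsetSeparating {i = i} i≢j (suc zero) _ _ = ⁅ i ⁆ , ∣⁅x⁆∣≡1 i , x∈⁅x⁆ i , x≢y⇒x∉⁅y⁆ (i≢j ∘ sym)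
subsetSeparating {i = zero}  {zero}  i≢j _ _ _ = ⊥-elim (i≢j refl)
subsetSeparating {i = zero}  {suc j} _   (suc m) _ (s≤s m<n) with subsetAvoiding j m m<n
... | J , ∣J∣≡m , j∉J = inside ∷ J , cong suc ∣J∣≡m , here , λ { (there j∈J) → j∉J j∈J }
subsetSeparating {i = suc i} {zero}  _   m 1≤m (s≤s m≤n) with subsetContaining i m 1≤m m≤n
... | J , ∣J∣≡m , i∈J = outside ∷ J , ∣J∣≡m , there i∈J , λ ()
subsetSeparating {i = suc i} {suc j} i≢j (suc (suc m)) _ (s≤s m<n)
  with subsetSeparating (i≢j ∘ cong suc) (suc m) (s≤s z≤n) m<n
... | J , ∣J∣≡m , i∈J , j∉J = inside ∷ J , cong suc ∣J∣≡m , there i∈J , λ { (there j∈J) → j∉J j∈J }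

record Adjacent (x y : Point s k) : Set where
  constructor adjacent
  field
    direction : Fin k
    differs   : lookup x direction ≢ lookup y direction
    agrees    : ∀ i → i ≢ direction → lookup x i ≡ lookup y i
open Adjacent using (direction)

module AdjacencyByFlats {s k : ℕ} (t : ℕ) (1≤t : 1 ≤ t) (t<k : t < k) where

  Between : Point s k → Point s k → Point s k → Set
  Between x y z = ∀ I a → ∣ I ∣ ≡ t → Agree I a x → Agree I a y → Agree I a z

  FlatAdjacent : Point s k → Point s k → Set
  FlatAdjacent x y = (x ≢ y) × (∀ z → Between x y z → z ≢ x → Between x z y)

  separating : ∀ {i j : Fin k} → i ≢ j → Σ (Subset k) λ I → (∣ I ∣ ≡ t) × (i ∈ I) × (j ∉ I)
  separating i≢j = subsetSeparating i≢j t 1≤t t<k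

  -- If x and y differ only at j, the t-flats through x that avoid j show
  -- that every point z between them differs from x only at j; if z ≠ x, a
  -- t-flat through x and z must avoid j, so it contains y as well.
  adjacent⇒flatAdjacent : ∀ x y → Adjacent x y → FlatAdjacent x y
  adjacent⇒flatAdjacent x y (adjacent j x≢y-at-j same-off-j) = x≢y , between-x-z
    where
    x≢y : x ≢ y
    x≢y x≡y = x≢y-at-j (cong (λ v → lookup v j) x≡y)
    off-j : ∀ z → Between x y z → ∀ i → i ≢ j → lookup z i ≡ lookup x i
    off-j z z-between i i≢j with separating i≢j
    ... | I , ∣I∣≡t , i∈I , j∉I =
      z-between I x ∣I∣≡t (λ _ _ → refl) (λ l l∈I → sym (same-off-j l λ { refl → j∉I l∈I })) i i∈I
    between-x-z : ∀ z → Between x y z → z ≢ x → Between x z y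
    between-x-z z z-between z≢x I a ∣I∣≡t ag-x ag-z l l∈I with l ≟ j
    ... | no l≢j = trans (sym (same-off-j l l≢j)) (ag-x l l∈I)
    ... | yes refl = ⊥-elim (z≢x (point-ext z≡x-at))
      where
      z≡x-at : ∀ i → lookup z i ≡ lookup x i
      z≡x-at i with i ≟ l
      ... | yes refl = trans (ag-z i l∈I) (sym (ag-x i l∈I))
      ... | no i≢l  = off-j z z-between i i≢l

  -- If x and y differ at j, then z = x [ j ≔ y j ] lies between them, so y
  -- lies between x and z; the t-flats through x avoiding j then force y to
  -- agree with x off j.
  flatAdjacent⇒adjacent : ∀ x y → FlatAdjacent x y → Adjacent x y
  flatAdjacent⇒adjacent x y (x≢y , between-x-z) with all? (λ i → lookup x i ≟ lookup y i)
  ... | yes same = ⊥-elim (x≢y (point-ext same))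
  ... | no ¬same with ¬∀⟶∃¬ k _ (λ i → lookup x i ≟ lookup y i) ¬same
  ... | j , x≢y-at-j = adjacent j x≢y-at-j same-off-j
    where
    z : Point s k
    z = x [ j ]≔ lookup y j
    z≢x : z ≢ x
    z≢x z≡x = x≢y-at-j (trans (sym (cong (λ v → lookup v j) z≡x)) (lookup∘updateAt j x))
    z-between : Between x y z
    z-between I a ∣I∣≡t ag-x ag-y l l∈I with l ≟ j
    ... | yes refl = ⊥-elim (x≢y-at-j (trans (ag-x l l∈I) (sym (ag-y l l∈I))))
    ... | no l≢j   = trans (lookup∘updateAt′ l j l≢j x) (ag-x l l∈I)
    same-off-j : ∀ i → i ≢ j → lookup x i ≡ lookup y i
    same-off-j i i≢j with separating i≢j
    ... | I , ∣I∣≡t , i∈I , j∉I =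
      sym (between-x-z z z-between z≢x I x ∣I∣≡t (λ _ _ → refl)
             (λ l l∈I → lookup∘updateAt′ l j (λ { refl → j∉I l∈I }) x) i i∈I)

  -- A bijection f (with inverse g) such that f and g carry t-flats onto
  -- t-flats preserves betweenness, hence adjacency.
  module _ (f g : Point s k → Point s k) (gf : ∀ x → g (f x) ≡ x) (fg : ∀ y → f (g y) ≡ y)
           (flats-f : MapsFlats t f) (flats-g : MapsFlats t g) where

    between-image : ∀ {x y z} → Between x y z → Between (f x) (f y) (f z)
    between-image {x} {y} {z} z-between J b ∣J∣≡t ag-x ag-y with flats-g J b ∣J∣≡t
    ... | I , a , ∣I∣≡t , img = proj₂ (img (f z)) (subst (Agree I a) (sym (gf z))
      (z-between I a ∣I∣≡t (subst (Agree I a) (gf x) (proj₁ (img (f x)) ag-x))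
                           (subst (Agree I a) (gf y) (proj₁ (img (f y)) ag-y))))

    between-preimage : ∀ {x y z} → Between (f x) (f y) (f z) → Between x y z
    between-preimage {x} {y} {z} z-between I a ∣I∣≡t ag-x ag-y with flats-f I a ∣I∣≡t
    ... | J , b , ∣J∣≡t , img =
      proj₂ (img z) (z-between J b ∣J∣≡t (proj₁ (img x) ag-x) (proj₁ (img y) ag-y))

    flatAdjacent-image : ∀ {x y} → FlatAdjacent x y → FlatAdjacent (f x) (f y)
    flatAdjacent-image {x} {y} (x≢y , between-x-z) = fx≢fy , between-fx-z′
      where
      fx≢fy : f x ≢ f y
      fx≢fy fx≡fy = x≢y (trans (sym (gf x)) (trans (cong g fx≡fy) (gf y)))
      -- Pull z′ back to g z′, apply the hypothesis there and push forward.
      between-fx-z′ : ∀ z′ → Between (f x) (f y) z′ → z′ ≢ f x → Between (f x) z′ (f y)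
      between-fx-z′ z′ z′-between z′≢fx =
        subst (λ w → Between (f x) w (f y)) (fg z′)
          (between-image (between-x-z (g z′)
            (between-preimage (subst (Between (f x) (f y)) (sym (fg z′)) z′-between))
            (λ gz′≡x → z′≢fx (trans (sym (fg z′)) (cong f gz′≡x)))))

    adjacent-image : ∀ x y → Adjacent x y → Adjacent (f x) (f y)
    adjacent-image x y adj =
      flatAdjacent⇒adjacent (f x) (f y) (flatAdjacent-image (adjacent⇒flatAdjacent x y adj))

update-adjacent : ∀ (x : Point s k) j c → c ≢ lookup x j → Adjacent x (x [ j ]≔ c)
update-adjacent x j c c≢ =
  adjacent j (λ eq → c≢ (sym (trans eq (lookup∘updateAt j x)))) (λ i i≢j → sym (lookup∘updateAt′ i j i≢j x))

updates-adjacent : ∀ (x : Point s k) j {c c′} → c ≢ c′ → Adjacent (x [ j ]≔ c) (x [ j ]≔ c′)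
updates-adjacent x j c≢c′ =
  adjacent j (λ eq → c≢c′ (trans (sym (lookup∘updateAt j x)) (trans eq (lookup∘updateAt j x))))
             (λ i i≢j → trans (lookup∘updateAt′ i j i≢j x) (sym (lookup∘updateAt′ i j i≢j x)))

direction-unique : ∀ {u v u′ v′ : Point s k} → u ≡ u′ → v ≡ v′ →
                   (A : Adjacent u v) (B : Adjacent u′ v′) → direction A ≡ direction B
direction-unique refl refl (adjacent d u≢v-at-d _) (adjacent e _ same-off-e) with d ≟ e
... | yes d≡e = d≡e
... | no d≢e  = ⊥-elim (u≢v-at-d (same-off-e d d≢e))

triangle : ∀ {q u v : Point s k} (A : Adjacent q u) (B : Adjacent q v) → Adjacent u v →
           direction A ≡ direction B
triangle (adjacent d q≢u-at-d qu-off-d) (adjacent d′ q≢v-at-d′ qv-off-d′) (adjacent e _ uv-off-e)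
  with d ≟ d′
... | yes d≡d′ = d≡d′
... | no d≢d′ with e ≟ d
...   | no e≢d = ⊥-elim (q≢u-at-d (trans (qv-off-d′ d d≢d′) (sym (uv-off-e d (e≢d ∘ sym)))))
...   | yes refl = ⊥-elim (q≢v-at-d′ (trans (qu-off-d d′ (d≢d′ ∘ sym)) (uv-off-e d′ (d≢d′ ∘ sym))))

differs-at : ∀ {u x y : Point s k} (A : Adjacent u x) (B : Adjacent u y) l →
             lookup x l ≢ lookup y l → direction A ≡ l ⊎ direction B ≡ l
differs-at (adjacent r _ ux-off-r) (adjacent r′ _ uy-off-r′) l x≢y-at-l with r ≟ l | r′ ≟ l
... | yes r≡l | _        = inj₁ r≡l
... | no _    | yes r′≡l = inj₂ r′≡l
... | no r≢l  | no r′≢l  =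
  ⊥-elim (x≢y-at-l (trans (sym (ux-off-r l (r≢l ∘ sym))) (uy-off-r′ l (r′≢l ∘ sym))))

-- The common neighbours of X [ p ≔ α ] and X [ q ≔ β ] (points at distance
-- 2) are X and X [ p ≔ α ][ q ≔ β ]: by differs-at the two edges from u
-- have directions p and q, in one order or the other.
common-neighbour : ∀ (X u : Point s k) {p q α β} → p ≢ q → α ≢ lookup X p → β ≢ lookup X q →
                   Adjacent u (X [ p ]≔ α) → Adjacent u (X [ q ]≔ β) →
                   u ≢ X [ p ]≔ α [ q ]≔ β → u ≡ X
common-neighbour X u {p} {q} {α} {β} p≢q α≢ β≢ A@(adjacent r _ u≈A) B@(adjacent r′ _ u≈B) u≢far
  with differs-at A B p at-p | differs-at A B q at-q
  where
  at-p : lookup (X [ p ]≔ α) p ≢ lookup (X [ q ]≔ β) p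
  at-p eq = α≢ (trans (sym (lookup∘updateAt p X)) (trans eq (lookup∘updateAt′ p q p≢q X)))
  at-q : lookup (X [ p ]≔ α) q ≢ lookup (X [ q ]≔ β) q
  at-q eq = β≢ (trans (sym (lookup∘updateAt q X)) (trans (sym eq) (lookup∘updateAt′ q p (p≢q ∘ sym) X)))
... | inj₁ r≡p  | inj₁ r≡q  = ⊥-elim (p≢q (trans (sym r≡p) r≡q))
... | inj₂ r′≡p | inj₂ r′≡q = ⊥-elim (p≢q (trans (sym r′≡p) r′≡q))
... | inj₁ refl | inj₂ refl = point-ext at
  where
  at : ∀ l → lookup u l ≡ lookup X l
  at l with l ≟ p
  ... | yes refl = trans (u≈B l p≢q) (lookup∘updateAt′ l q p≢q X)
  ... | no l≢p   = trans (u≈A l l≢p) (lookup∘updateAt′ l p l≢p X)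
... | inj₂ refl | inj₁ refl = ⊥-elim (u≢far (point-ext at))
  where
  at : ∀ l → lookup u l ≡ lookup (X [ p ]≔ α [ q ]≔ β) l
  at l with l ≟ q
  ... | yes refl = trans (u≈B l (p≢q ∘ sym))
                     (trans (lookup∘updateAt l X) (sym (lookup∘updateAt l (X [ p ]≔ α))))
  ... | no l≢q   = trans (u≈A l l≢q) (sym (lookup∘updateAt′ l q l≢q (X [ p ]≔ α)))

module HammingAutomorphism (s₀ k : ℕ) where

  Level : Set
  Level = Fin (suc (suc s₀))

  Pt : Set
  Pt = Point (suc (suc s₀)) k

  origin : Pt
  origin = replicate k zero

  -- A level different from c; this is where s ≥ 2 is used.
  other : Level → Level
  other zero    = suc zero
  other (suc _) = zero

  other≢ : ∀ c → other c ≢ c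
  other≢ zero    ()
  other≢ (suc _) ()

  update-self : ∀ (x : Pt) j → x [ j ]≔ lookup x j ≡ x
  update-self x j = updateAt-id-local j x refl

  module Line (F : Pt → Pt) (F-adj : ∀ x y → Adjacent x y → Adjacent (F x) (F y)) (p : Pt) where

    firstStep : ∀ j → Adjacent (F p) (F (p [ j ]≔ other (lookup p j)))
    firstStep j = F-adj _ _ (update-adjacent p j _ (other≢ _))

    lineDirection : Fin k → Fin k
    lineDirection j = direction (firstStep j)

    -- All steps from p along j are sent to steps along lineDirection j,
    -- since two of them form a triangle with the first step.
    direction-on-line : ∀ j c (A : Adjacent (F p) (F (p [ j ]≔ c))) → direction A ≡ lineDirection j
    direction-on-line j c A with c ≟ other (lookup p j)
    ... | yes refl = direction-unique refl refl A (firstStep j)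
    ... | no c≢    = triangle A (firstStep j) (F-adj _ _ (updates-adjacent p j c≢))

    line-image : ∀ j c → F (p [ j ]≔ c) ≡ F p [ lineDirection j ]≔ lookup (F (p [ j ]≔ c)) (lineDirection j)
    line-image j c with c ≟ lookup p j
    ... | yes refl = begin
      F (p [ j ]≔ lookup p j)                     ≡⟨ cong F (update-self p j) ⟩
      F p                                         ≡⟨ update-self (F p) d ⟨
      F p [ d ]≔ lookup (F p) d                   ≡⟨ cong (λ v → F p [ d ]≔ lookup (F v) d) (update-self p j) ⟨
      F p [ d ]≔ lookup (F (p [ j ]≔ lookup p j)) d ∎
      where
      open ≡-Reasoning
      d : Fin k
      d = lineDirection j
    ... | no c≢ = point-ext at
      where
      d : Fin k
      d = lineDirection j
      A : Adjacent (F p) (F (p [ j ]≔ c))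
      A = F-adj _ _ (update-adjacent p j c c≢)
      at : ∀ i → lookup (F (p [ j ]≔ c)) i ≡ lookup (F p [ d ]≔ lookup (F (p [ j ]≔ c)) d) i
      at i with i ≟ d
      ... | yes refl = sym (lookup∘updateAt i (F p))
      ... | no i≢d   = trans (sym (Adjacent.agrees A i (λ i≡ → i≢d (trans i≡ (direction-on-line j c A)))))
                             (sym (lookup∘updateAt′ i d i≢d (F p)))

  -- If G ∘ F = id, the line directions of G at F p invert those of F at p:
  -- G maps the step F p → F (p [ j ≔ c ]) back to the step p → p [ j ≔ c ].
  lineDirection-inverse : ∀ (F G : Pt → Pt) F-adj G-adj → (∀ x → G (F x) ≡ x) → ∀ p q → F p ≡ q →
                          ∀ j → Line.lineDirection G G-adj q (Line.lineDirection F F-adj p j) ≡ j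
  lineDirection-inverse F G F-adj G-adj GF p .(F p) refl j = begin
    LG.lineDirection d    ≡⟨ LG.direction-on-line d e B ⟨
    direction B           ≡⟨ direction-unique (GF p) G-step B (update-adjacent p j c (other≢ _)) ⟩
    j                     ∎
    where
    open ≡-Reasoning
    module LF = Line F F-adj p
    module LG = Line G G-adj (F p)
    c : Level
    c = other (lookup p j)
    d : Fin k
    d = LF.lineDirection j
    e : Level
    e = lookup (F (p [ j ]≔ c)) d
    e≢ : e ≢ lookup (F p) d
    e≢ eq = Adjacent.differs (LF.firstStep j) (sym eq)
    B : Adjacent (G (F p)) (G (F p [ d ]≔ e))
    B = G-adj _ _ (update-adjacent (F p) d e e≢)
    G-step : G (F p [ d ]≔ e) ≡ p [ j ]≔ c
    G-step = trans (cong G (sym (LF.line-image j c))) (GF _)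

  hammingWeight : ∀ {n} → Vec Level n → ℕ
  hammingWeight []          = 0
  hammingWeight (zero ∷ x)  = hammingWeight x
  hammingWeight (suc _ ∷ x) = suc (hammingWeight x)

  weight-zero : ∀ {n} (x : Vec Level n) → hammingWeight x ≡ 0 → ∀ i → lookup x i ≡ zero
  weight-zero (zero ∷ x)  w≡0 zero    = refl
  weight-zero (zero ∷ x)  w≡0 (suc i) = weight-zero x w≡0 i
  weight-zero (suc _ ∷ x) () i

  nonzero-coordinate : ∀ {n} (x : Vec Level n) m → hammingWeight x ≡ suc m →
                       Σ (Fin n) λ i → (lookup x i ≢ zero) × (hammingWeight (x [ i ]≔ zero) ≡ m)
  nonzero-coordinate (zero ∷ x) m w≡ with nonzero-coordinate x m w≡
  ... | i , x≢0 , w′ = suc i , x≢0 , w′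
  nonzero-coordinate (suc c ∷ x) m w≡ = zero , (λ ()) , suc-injective w≡

  weight-clear : ∀ {n} (x : Vec Level n) i → lookup x i ≢ zero →
                 hammingWeight x ≡ suc (hammingWeight (x [ i ]≔ zero))
  weight-clear (zero ∷ x)  zero    x≢0 = ⊥-elim (x≢0 refl)
  weight-clear (suc c ∷ x) zero    x≢0 = refl
  weight-clear (zero ∷ x)  (suc i) x≢0 = weight-clear x i x≢0
  weight-clear (suc c ∷ x) (suc i) x≢0 = cong suc (weight-clear x i x≢0)

  -- By induction on the weight of x: clearing two nonzero
  -- coordinates of x gives points where f = h, and f x must be the common
  -- neighbour h x of their images.
  module Rigidity (f g : Pt → Pt) (gf : ∀ x → g (f x) ≡ x)
                  (f-adj : ∀ x y → Adjacent x y → Adjacent (f x) (f y))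
                  {τ : Permutation′ k} {φ : Fin k → Permutation′ (suc (suc s₀))} {h : Pt → Pt}
                  (mono : IsMonomial τ φ h)
                  (at-origin : f origin ≡ h origin)
                  (on-lines : ∀ j c → f (origin [ j ]≔ c) ≡ h (origin [ j ]≔ c)) where

    step-towards : ∀ x i → lookup x i ≢ zero → f (x [ i ]≔ zero) ≡ h (x [ i ]≔ zero) →
                   Adjacent (f x) (h x [ τ ⟨$⟩ʳ i ]≔ (φ i ⟨$⟩ʳ zero))
    step-towards x i x≢0 agree = subst (Adjacent (f x)) (trans agree (monomial-update mono x i zero))
                                   (f-adj _ _ (update-adjacent x i zero (x≢0 ∘ sym)))

    moved-level : ∀ x i → lookup x i ≢ zero → φ i ⟨$⟩ʳ zero ≢ lookup (h x) (τ ⟨$⟩ʳ i)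
    moved-level x i x≢0 eq = x≢0 (sym (perm-injective (φ i) (trans eq (moves mono x i))))

    weight-two-step : ∀ m x → hammingWeight x ≡ suc (suc m) →
                      (∀ y → hammingWeight y ≡ suc m → f y ≡ h y) →
                      (∀ y → hammingWeight y ≡ m → f y ≡ h y) → f x ≡ h x
    weight-two-step m x w≡ agree₁ agree₀ with nonzero-coordinate x (suc m) w≡
    ... | i , xi≢0 , wi with nonzero-coordinate (x [ i ]≔ zero) m wi
    ... | j , yj≢0 , wz =
      common-neighbour (h x) (f x) τi≢τj (moved-level x i xi≢0) (moved-level x j xj≢0)
        (step-towards x i xi≢0 (agree₁ _ wi)) (step-towards x j xj≢0 (agree₁ _ wj)) fx≢far
      where
      j≢i : j ≢ i
      j≢i refl = yj≢0 (lookup∘updateAt j x)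
      xj≢0 : lookup x j ≢ zero
      xj≢0 eq = yj≢0 (trans (lookup∘updateAt′ j i j≢i x) eq)
      wj : hammingWeight (x [ j ]≔ zero) ≡ suc m
      wj = suc-injective (trans (sym (weight-clear x j xj≢0)) w≡)
      τi≢τj : τ ⟨$⟩ʳ i ≢ τ ⟨$⟩ʳ j
      τi≢τj eq = j≢i (sym (perm-injective τ eq))
      -- With both coordinates cleared we reach z, whose image is the far
      -- common neighbour; f x differs from it because x ≠ z.
      z : Pt
      z = x [ i ]≔ zero [ j ]≔ zero
      hz : h z ≡ h x [ τ ⟨$⟩ʳ i ]≔ (φ i ⟨$⟩ʳ zero) [ τ ⟨$⟩ʳ j ]≔ (φ j ⟨$⟩ʳ zero)
      hz = trans (monomial-update mono _ j zero)
                 (cong (λ v → v [ τ ⟨$⟩ʳ j ]≔ (φ j ⟨$⟩ʳ zero)) (monomial-update mono x i zero))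
      fx≢far : f x ≢ h x [ τ ⟨$⟩ʳ i ]≔ (φ i ⟨$⟩ʳ zero) [ τ ⟨$⟩ʳ j ]≔ (φ j ⟨$⟩ʳ zero)
      fx≢far eq = xi≢0 (begin
        lookup x i                   ≡⟨ cong (λ v → lookup v i) x≡z ⟩
        lookup z i                   ≡⟨ lookup∘updateAt′ i j (j≢i ∘ sym) (x [ i ]≔ zero) ⟩
        lookup (x [ i ]≔ zero) i     ≡⟨ lookup∘updateAt i x ⟩
        zero                         ∎)
        where
        open ≡-Reasoning
        x≡z : x ≡ z
        x≡z = trans (sym (gf x)) (trans (cong g (trans eq (trans (sym hz) (sym (agree₀ z wz))))) (gf z))

    agree-of-weight : ∀ n x → hammingWeight x ≡ n → f x ≡ h x
    agree-of-weight zero x w≡ = subst (λ v → f v ≡ h v) (sym x≡origin) at-origin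
      where
      x≡origin : x ≡ origin
      x≡origin = point-ext λ i → trans (weight-zero x w≡ i) (sym (lookup-replicate i zero))
    agree-of-weight (suc zero) x w≡ with nonzero-coordinate x 0 w≡
    ... | i , _ , w₀ = subst (λ v → f v ≡ h v) (sym x-on-line) (on-lines i (lookup x i))
      where
      x-on-line : x ≡ origin [ i ]≔ lookup x i
      x-on-line = point-ext at
        where
        at : ∀ l → lookup x l ≡ lookup (origin [ i ]≔ lookup x i) l
        at l with l ≟ i
        ... | yes refl = sym (lookup∘updateAt l origin)
        ... | no l≢i   = begin
          lookup x l                            ≡⟨ lookup∘updateAt′ l i l≢i x ⟨
          lookup (x [ i ]≔ zero) l              ≡⟨ weight-zero (x [ i ]≔ zero) w₀ l ⟩
          zero                                  ≡⟨ lookup-replicate l zero ⟨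
          lookup origin l                       ≡⟨ lookup∘updateAt′ l i l≢i origin ⟨
          lookup (origin [ i ]≔ lookup x i) l   ∎
          where open ≡-Reasoning
    agree-of-weight (suc (suc m)) x w≡ =
      weight-two-step m x w≡ (agree-of-weight (suc m)) (agree-of-weight m)

    agree : ∀ x → f x ≡ h x
    agree x = agree-of-weight _ x refl

  -- A bijection f (inverse g) preserving adjacency both ways is monomial:
  -- coordinate j goes to the direction τ j of the image of the line through
  -- the origin along j, and level c to the level that f (origin [ j ≔ c ])
  -- has there.
  module Automorphism (f g : Pt → Pt) (gf : ∀ x → g (f x) ≡ x) (fg : ∀ y → f (g y) ≡ y)
                      (f-adj : ∀ x y → Adjacent x y → Adjacent (f x) (f y))
                      (g-adj : ∀ x y → Adjacent x y → Adjacent (g x) (g y)) where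

    module Lf = Line f f-adj origin
    module Lg = Line g g-adj (f origin)

    τ : Permutation′ k
    τ = permutation Lf.lineDirection Lg.lineDirection
          (lineDirection-inverse g f g-adj f-adj fg (f origin) origin (gf origin))
          (lineDirection-inverse f g f-adj g-adj gf origin (f origin) refl)

    relabel unrelabel : Fin k → Level → Level
    relabel   j c = lookup (f (origin [ j ]≔ c)) (τ ⟨$⟩ʳ j)
    unrelabel j d = lookup (g (f origin [ τ ⟨$⟩ʳ j ]≔ d)) j

    line-f : ∀ j c → f (origin [ j ]≔ c) ≡ f origin [ τ ⟨$⟩ʳ j ]≔ relabel j c
    line-f = Lf.line-image

    line-g : ∀ j d → g (f origin [ τ ⟨$⟩ʳ j ]≔ d) ≡ origin [ j ]≔ unrelabel j d
    line-g j d = trans (Lg.line-image (τ ⟨$⟩ʳ j) d)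
                       (cong₂ (λ base m → base [ m ]≔ lookup (g (f origin [ τ ⟨$⟩ʳ j ]≔ d)) m)
                              (gf origin) (inverseˡ τ))

    φ : Fin k → Permutation′ (suc (suc s₀))
    φ j = permutation (relabel j) (unrelabel j) relabel-unrelabel unrelabel-relabel
      where
      relabel-unrelabel : ∀ d → relabel j (unrelabel j d) ≡ d
      relabel-unrelabel d = begin
        lookup (f (origin [ j ]≔ unrelabel j d)) (τ ⟨$⟩ʳ j)     ≡⟨ cong (λ v → lookup (f v) (τ ⟨$⟩ʳ j)) (line-g j d) ⟨
        lookup (f (g (f origin [ τ ⟨$⟩ʳ j ]≔ d))) (τ ⟨$⟩ʳ j)    ≡⟨ cong (λ v → lookup v (τ ⟨$⟩ʳ j)) (fg _) ⟩
        lookup (f origin [ τ ⟨$⟩ʳ j ]≔ d) (τ ⟨$⟩ʳ j)            ≡⟨ lookup∘updateAt (τ ⟨$⟩ʳ j) (f origin) ⟩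
        d                                                      ∎
        where open ≡-Reasoning
      unrelabel-relabel : ∀ c → unrelabel j (relabel j c) ≡ c
      unrelabel-relabel c = begin
        lookup (g (f origin [ τ ⟨$⟩ʳ j ]≔ relabel j c)) j     ≡⟨ cong (λ v → lookup (g v) j) (line-f j c) ⟨
        lookup (g (f (origin [ j ]≔ c))) j                    ≡⟨ cong (λ v → lookup v j) (gf _) ⟩
        lookup (origin [ j ]≔ c) j                            ≡⟨ lookup∘updateAt j origin ⟩
        c                                                     ∎
        where open ≡-Reasoning

    -- The monomial map with these data agrees with f on the lines through
    -- the origin, hence everywhere.
    h : Pt → Pt
    h = eval (proj₁ (monomial-word τ φ))

    h-monomial : IsMonomial τ φ h
    h-monomial = proj₂ (monomial-word τ φ)

    at-origin : f origin ≡ h origin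
    at-origin = ext-along τ λ j → begin
      lookup (f origin) (τ ⟨$⟩ʳ j)                       ≡⟨ cong (λ v → lookup (f v) (τ ⟨$⟩ʳ j)) (update-self origin j) ⟨
      lookup (f (origin [ j ]≔ lookup origin j)) (τ ⟨$⟩ʳ j) ≡⟨ moves h-monomial origin j ⟨
      lookup (h origin) (τ ⟨$⟩ʳ j)                       ∎
      where open ≡-Reasoning

    on-lines : ∀ j c → f (origin [ j ]≔ c) ≡ h (origin [ j ]≔ c)
    on-lines j c = begin
      f (origin [ j ]≔ c)                              ≡⟨ line-f j c ⟩
      f origin [ τ ⟨$⟩ʳ j ]≔ (φ j ⟨$⟩ʳ c)              ≡⟨ cong (λ v → v [ τ ⟨$⟩ʳ j ]≔ (φ j ⟨$⟩ʳ c)) at-origin ⟩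
      h origin [ τ ⟨$⟩ʳ j ]≔ (φ j ⟨$⟩ʳ c)              ≡⟨ monomial-update h-monomial origin j c ⟨
      h (origin [ j ]≔ c)                              ∎
      where open ≡-Reasoning

    f-monomial : Monomial f
    f-monomial = τ , φ , monomial λ x i →
      trans (cong (λ v → lookup v (τ ⟨$⟩ʳ i)) (Rigidity.agree f g gf f-adj h-monomial at-origin on-lines x))
            (moves h-monomial x i)

-- For 1 ≤ t < k every permutation preserving the system lies in G_{s,k}:
-- σ and σ⁻¹ carry t-flats onto t-flats, hence preserve Hamming adjacency,
-- hence σ is monomial.
preserves⇒inGsk : ∀ s₀ k t λ' → 1 ≤ t → t < k → (σ : PointPerm (suc (suc s₀)) k) →
                  Preserves t λ' σ → InGsk σ
preserves⇒inGsk s₀ k t λ' 1≤t t<k σ pres =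
  monomial⇒inGsk σ (HammingAutomorphism.Automorphism.f-monomial s₀ k to from (from-to σ) (to-from σ)
                      (adjacent-image to from (from-to σ) (to-from σ) flats-to flats-from)
                      (adjacent-image from to (to-from σ) (from-to σ) flats-from flats-to))
  where
  open AdjacencyByFlats t 1≤t t<k using (adjacent-image)
  to from : Point (suc (suc s₀)) k → Point (suc (suc s₀)) k
  to   = Inverse.to σ
  from = Inverse.from σ
  flats-to : MapsFlats t to
  flats-to = preserves⇒flats-to σ t λ' pres
  flats-from : MapsFlats t from
  flats-from = preserves⇒flats-from σ t λ' pres

theorem13 : (s k t λ' : ℕ) → 2 ≤ s → 1 ≤ k → t ≤ k → 1 ≤ λ' →
    ((t ≢ 0 × t ≢ k) → (σ : PointPerm s k) → Preserves t λ' σ ⇔ InGsk σ) ×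
    ((t ≡ 0 ⊎ t ≡ k) → (σ : PointPerm s k) → Preserves t λ' σ)
theorem13 (suc (suc s₀)) k t λ' (s≤s (s≤s z≤n)) _ t≤k _ = nondegenerate , degenerate
  where
  nondegenerate : (t ≢ 0 × t ≢ k) → (σ : PointPerm (suc (suc s₀)) k) → Preserves t λ' σ ⇔ InGsk σ
  nondegenerate (t≢0 , t≢k) σ =
    mk⇔ (preserves⇒inGsk s₀ k t λ' (n≢0⇒n>0 t≢0) (≤∧≢⇒< t≤k t≢k) σ) (inGsk⇒preserves t λ' σ)

  degenerate : (t ≡ 0 ⊎ t ≡ k) → (σ : PointPerm (suc (suc s₀)) k) → Preserves t λ' σ
  degenerate (inj₁ t≡0) σ =
    flats⇒preserves σ t λ' (mapsFlats-t≡0 t≡0 (Inverse.to σ)) (mapsFlats-t≡0 t≡0 (Inverse.from σ))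
  degenerate (inj₂ t≡k) σ =
    flats⇒preserves σ t λ' (mapsFlats-t≡k t≡k (Inverse.to σ) (to-injective σ))
                            (mapsFlats-t≡k t≡k (Inverse.from σ) (from-injective σ))
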